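{- The path graph $L_n$ is the only simple graph $\Gamma$ on $n$ vertices such that the quasisymmetric functions $\Psi^1_q(\Gamma^{\mathbf 1}),\Psi^2_q(\Gamma^{\mathbf 1}),\ldots,\Psi^{n-1}_q(\Gamma^{\mathbf 1})$ are pairwise different.
   Context: $L_n$ is the graph on $[n]$ with edges $\{i,i+1\}$, $1\le i<n$. $\Gamma^{\mathbf 1}$ is $\Gamma$ with every edge decorated by $1$. For a decorated graph $\Gamma^w$ (simple graph with edge map $w:E\to\mathbb{N}$) and $S\subseteq V$: $\Gamma^w|_S$ is the induced decorated subgraph; $\Gamma^w/S$ is the decorated graph on $V\setminus S$ consisting of the induced edges plus an edge $uv$ for every pair $u,v\notin S$ joined by a path with all interior vertices in $S$, decorated by the minimum total decoration of such paths. $\mathrm{pr}_m$ deletes all edges of decoration $>m$. A flag is a strict chain $\mathcal F:\emptyset=F_0\subset\cdots\subset F_k=[n]$ of type $(|F_1|-|F_0|,\ldots,|F_k|-|F_{k-1}|)$; $M_{\mathcal F}=M_{\mathsf{type}(\mathcal F)}$ is the monomial quasisymmetric function. With $\mathsf{rk}_m(\Gamma^w/\mathcal F)=n-\sum_{i}c(\mathrm{pr}_m(\Gamma^w|_{F_i}/F_{i-1}))$ ($c$ = number of connected components), $\Psi^m_q(\Gamma^w)=\sum_{\mathcal F}q^{\mathsf{rk}_m(\Gamma^w/\mathcal F)}M_{\mathcal F}$. -}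

module Defs where

open import Data.Bool using (Bool; true; false; _∧_; _∨_; not; if_then_else_)
open import Data.Bool.Properties using (∨-comm)
open import Data.Nat using (ℕ; zero; suc; _+_; _∸_; _≡ᵇ_; _<ᵇ_; _≤ᵇ_)
open import Data.Fin using (Fin; toℕ)
open import Data.List using (List; []; _∷_; [_]; _++_; map; foldr; concatMap; filterᵇ; allFin; upTo; length)
open import Data.Bool.ListAction using (all; any)
open import Data.Nat.ListAction using (sum)
open import Data.Maybe using (Maybe; just; nothing; is-just)
open import Data.Product using (_×_; _,_; Σ-syntax)
open import Relation.Binary.PropositionalEquality using (_≡_; refl)
open import Relation.Nullary using (¬_)
open import Function.Bundles using (_↔_; Inverse)

record SimpleGraph (n : ℕ) : Set where
  field
    adj    : Fin n → Fin n → Bool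
    sym    : ∀ u v → adj u v ≡ adj v u
    irrefl : ∀ v → adj v v ≡ false
open SimpleGraph public

_==F_ : ∀ {n} → Fin n → Fin n → Bool
u ==F v = toℕ u ≡ᵇ toℕ v

private
  suc≢ᵇ : ∀ m → (suc m ≡ᵇ m) ≡ false
  suc≢ᵇ zero    = refl
  suc≢ᵇ (suc m) = suc≢ᵇ m

L : (n : ℕ) → SimpleGraph n
L n = record
  { adj    = λ u v → (suc (toℕ u) ≡ᵇ toℕ v) ∨ (suc (toℕ v) ≡ᵇ toℕ u)
  ; sym    = λ u v → ∨-comm (suc (toℕ u) ≡ᵇ toℕ v) (suc (toℕ v) ≡ᵇ toℕ u)
  ; irrefl = λ v → irr (toℕ v)
  }
  where
  irr : ∀ m → ((suc m ≡ᵇ m) ∨ (suc m ≡ᵇ m)) ≡ false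
  irr m rewrite suc≢ᵇ m = refl

_≅_ : ∀ {n} → SimpleGraph n → SimpleGraph n → Set
_≅_ {n} Γ Δ = Σ[ σ ∈ (Fin n ↔ Fin n) ]
  (∀ u v → adj Γ u v ≡ adj Δ (Inverse.to σ u) (Inverse.to σ v))

-- Decorated graphs whose vertex set is a subset V ⊆ [n].
-- wt u v = just d : edge uv with decoration d;  nothing : no edge.
-- (Only pairs with both ends in V are meaningful; see `wt∣`.)

record DecGraph (n : ℕ) : Set where
  field
    vert : Fin n → Bool
    wt   : Fin n → Fin n → Maybe ℕ
open DecGraph public

wt∣ : ∀ {n} → DecGraph n → Fin n → Fin n → Maybe ℕ
wt∣ G u v = if vert G u ∧ vert G v then wt G u v else nothing

deco1 : ∀ {n} → SimpleGraph n → DecGraph n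
deco1 Γ = record
  { vert = λ _ → true
  ; wt   = λ u v → if adj Γ u v then just 1 else nothing }

induced : ∀ {n} → DecGraph n → (Fin n → Bool) → DecGraph n
induced G S = record
  { vert = λ v → vert G v ∧ S v
  ; wt   = λ u v → if S u ∧ S v then wt∣ G u v else nothing }

walkWeight : ∀ {n} → (Fin n → Fin n → Maybe ℕ) → List (Fin n) → Maybe ℕ
walkWeight w (x ∷ y ∷ rest) with w x y | walkWeight w (y ∷ rest)
... | just a | just b = just (a + b)
... | _      | _      = nothing
walkWeight w _ = just 0

minM : Maybe ℕ → Maybe ℕ → Maybe ℕ
minM nothing  y        = y
minM (just a) nothing  = just a
minM (just a) (just b) = just (if a ≤ᵇ b then a else b)

listsOfLen : ∀ n → ℕ → List (List (Fin n))
listsOfLen n zero    = [ [] ]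
listsOfLen n (suc k) = concatMap (λ x → map (x ∷_) (listsOfLen n k)) (allFin n)

distinct : ∀ {n} → List (Fin n) → Bool
distinct []       = true
distinct (x ∷ xs) = not (any (x ==F_) xs) ∧ distinct xs

-- all repetition-free lists over [n] (necessarily of length ≤ n):
-- the possible sequences of interior vertices of a path
interiors : ∀ n → List (List (Fin n))
interiors n = filterᵇ distinct (concatMap (listsOfLen n) (upTo (suc n)))

-- Γ^w / S : vertex set V ∖ S; u ≠ v in V ∖ S are joined iff some path
-- u, x₁, …, x_k, v (k ≥ 0) has all interior vertices x_i in S; the
-- decoration is the minimum total decoration of such paths.
contract : ∀ {n} → DecGraph n → (Fin n → Bool) → DecGraph n
contract {n} G S = record { vert = V' ; wt = w' }
  where
  V' : Fin n → Bool
  V' v = vert G v ∧ not (S v)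
  pathW : Fin n → Fin n → List (Fin n) → Maybe ℕ
  pathW u v xs =
    if all (λ x → S x ∧ vert G x) xs
    then walkWeight (wt∣ G) (u ∷ xs ++ [ v ]) else nothing
  w' : Fin n → Fin n → Maybe ℕ
  w' u v = if V' u ∧ V' v ∧ not (u ==F v)
           then foldr minM nothing (map (pathW u v) (interiors n))
           else nothing

pr : ∀ {n} → ℕ → DecGraph n → DecGraph n
pr m G = record { vert = vert G ; wt = λ u v → keep (wt G u v) }
  where
  keep : Maybe ℕ → Maybe ℕ
  keep (just d) = if d ≤ᵇ m then just d else nothing
  keep nothing  = nothing

-- connectivity: reachK k u v  iff  v is reachable from u by a walk in G
-- of length ≤ k (walks of length ≤ n suffice)
reachK : ∀ {n} → DecGraph n → ℕ → Fin n → Fin n → Bool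
reachK G zero    u v = u ==F v
reachK {n} G (suc k) u v =
  reachK G k u v ∨ any (λ w → reachK G k u w ∧ is-just (wt∣ G w v)) (allFin n)

count : ∀ {n} → (Fin n → Bool) → ℕ
count {n} p = length (filterᵇ p (allFin n))

-- c(G): number of connected components = number of vertices of G that
-- are the least vertex of their component
components : ∀ {n} → DecGraph n → ℕ
components {n} G = count (λ v → vert G v ∧
  not (any (λ u → (toℕ u <ᵇ toℕ v) ∧ vert G u ∧ reachK G n u v) (allFin n)))

-- Flags.  A flag ∅ = F₀ ⊂ F₁ ⊂ ⋯ ⊂ F_k = [n] corresponds bijectively to
-- a surjection f : [n] → [k] (f v = j  iff  v ∈ F_{j+1} ∖ F_j),
-- via F_j = { v | f v < j }.

allFuns : ∀ k n → List (Fin n → Fin k)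
allFuns k zero    = [ (λ ()) ]
allFuns k (suc n) = concatMap (λ f → map (λ x → ext x f) (allFin k)) (allFuns k n)
  where
  ext : Fin k → (Fin n → Fin k) → Fin (suc n) → Fin k
  ext x f Fin.zero    = x
  ext x f (Fin.suc i) = f i

surjective : ∀ {k n} → (Fin n → Fin k) → Bool
surjective {k} {n} f = all (λ j → any (λ i → f i ==F j) (allFin n)) (allFin k)

record Flag (n : ℕ) : Set where
  constructor flag
  field
    len   : ℕ
    block : Fin n → Fin len
open Flag public

flags : ∀ n → List (Flag n)
flags n = concatMap (λ k → map (flag k) (filterᵇ surjective (allFuns k n))) (upTo (suc n))

F : ∀ {n} → Flag n → ℕ → Fin n → Bool
F 𝓕 j v = toℕ (block 𝓕 v) <ᵇ j

type : ∀ {n} → Flag n → List ℕ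
type 𝓕 = map (λ j → count (λ v → block 𝓕 v ==F j)) (allFin (len 𝓕))

rk : ∀ {n} → ℕ → DecGraph n → Flag n → ℕ
rk {n} m G 𝓕 = n ∸ sum (map (λ i →
  components (pr m (contract (induced G (F 𝓕 (suc i))) (F 𝓕 i)))) (upTo (len 𝓕)))

-- Quasisymmetric functions with coefficients in ℕ[q], written as formal
-- sums Σ q^r M_α, i.e. lists of terms (r , α).  Since the q^r M_α form a
-- basis, two such sums are equal iff all coefficients agree.

QSymℕq : Set
QSymℕq = List (ℕ × List ℕ)

eqListᵇ : List ℕ → List ℕ → Bool
eqListᵇ []       []       = true
eqListᵇ (a ∷ as) (b ∷ bs) = (a ≡ᵇ b) ∧ eqListᵇ as bs
eqListᵇ _        _        = false

coeff : QSymℕq → List ℕ → ℕ → ℕ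
coeff s α r = length (filterᵇ (λ { (r' , α') → (r' ≡ᵇ r) ∧ eqListᵇ α' α }) s)

_≈Q_ : QSymℕq → QSymℕq → Set
s ≈Q t = ∀ α r → coeff s α r ≡ coeff t α r

Ψ : ∀ {n} → ℕ → DecGraph n → QSymℕq
Ψ {n} m G = map (λ 𝓕 → (rk m G 𝓕 , type 𝓕)) (flags n)

PairwiseDifferentΨ : ∀ {n} → SimpleGraph n → Set
PairwiseDifferentΨ {n} Γ = ∀ m m' → 1 Data.Nat.≤ m → m Data.Nat.< n →
  1 Data.Nat.≤ m' → m' Data.Nat.< n → ¬ (m ≡ m') →
  ¬ (Ψ m (deco1 Γ) ≈Q Ψ m' (deco1 Γ))

-- If Ψ^m ≠ Ψ^{m+1}, some layer Γ^1|_{F_{i+1}}/F_i has an edge of decoration exactly m+1, that is, a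
-- shortest admissible path with m interior vertices. For m + 1 = n − 1 this path runs through all n
-- vertices, and being shortest it has no chords, so Γ is the path L_n.
-- Conversely, on L_n with 1 ≤ m < m′ < n, take the flag whose first block consists of all vertices except
-- those at positions 0 and m′. In the second layer these two ends are joined by an edge of decoration
-- exactly m′, so pr_{m′} of it has one component fewer than pr_m, while the first layer cannot gain
-- components. Hence rk_m < rk_{m′} on this flag and rk_m ≤ rk_{m′} on all flags, so for its composition
-- the number of flags of rank at most rk_m differs between Ψ^m and Ψ^{m′}.

module Submission where

open import Defs hiding (sym)

open import Data.Bool using (Bool; true; false; _∧_; _∨_; not; if_then_else_; T; T?)
open import Data.Bool.ListAction using (all; any)
open import Data.Bool.Properties using (T-≡; not-involutive; ∧-zeroʳ; ∧-identityʳ; ∨-identityʳ; ∨-comm)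
open import Data.Empty using (⊥-elim)
open import Data.Fin using (Fin; toℕ; punchOut)
open import Data.Fin.Properties using (toℕ-injective; toℕ<n)
import Data.Fin.Properties as Finₚ
open import Data.List
  using (List; []; _∷_; [_]; _++_; map; foldr; concatMap; filterᵇ; allFin; upTo; length; applyUpTo; applyDownFrom;
         InitLast; initLast; _∷ʳ′_)
open import Data.List.Membership.Propositional using (_∈_; lose)
open import Data.List.Membership.Propositional.Properties
  using (∈-applyUpTo⁻; ∈-applyDownFrom⁻; ∈-allFin; ∈-++⁺ˡ; ∈-++⁺ʳ; ∈-++⁻; ∈-map⁺; ∈-concatMap⁺; ∈-filter⁺; ∈-filter⁻; ∈-upTo⁺)
open import Data.List.Properties
  using (map-cong-local; applyUpTo-∷ʳ; applyDownFrom-∷ʳ; length-applyUpTo; length-applyDownFrom; length-tabulate;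
         ++-assoc; ∷-injectiveˡ; ∷-injectiveʳ; ∷ʳ-injective; length-++)
open import Data.List.Relation.Unary.All using ([]; _∷_)
import Data.List.Relation.Unary.All as All
import Data.List.Relation.Unary.All.Properties as All
open import Data.List.Relation.Unary.AllPairs using ([]; _∷_)
import Data.List.Relation.Unary.AllPairs.Properties as AllPairs
open import Data.List.Relation.Unary.Any using (here; there)
import Data.List.Relation.Unary.Any as Any
open import Data.List.Relation.Unary.Linked using (Linked; []; [-]; _∷_)
import Data.List.Relation.Unary.Linked as Linked
import Data.List.Relation.Unary.Linked.Properties as Linked
open import Data.List.Relation.Unary.Unique.Propositional using (Unique)
open import Data.Maybe using (Maybe; just; nothing; is-just)
import Data.Maybe.Properties as Maybeₚ
open import Data.Nat using (ℕ; zero; suc; _+_; _∸_; _≤_; _<_; z≤n; s≤s; _≡ᵇ_; _<ᵇ_; _≤ᵇ_; _≤?_; _≟_; ∣_-_∣)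
open import Data.Nat.DivMod using (_mod_; m<n⇒m%n≡m)
open import Data.Nat.ListAction using (sum)
open import Data.Nat.Properties
open import Algebra.Properties.CommutativeSemigroup +-commutativeSemigroup using (interchange)
open import Data.Product using (_×_; _,_; Σ-syntax; proj₁; proj₂)
open import Data.Sum using (_⊎_; inj₁; inj₂)
open import Function using (_∘_; id)
open import Function.Bundles using (_⇔_; _↔_; Equivalence; Inverse; mk↔ₛ′; mk⇔)
open import Function.Construct.Identity using (↔-id)
open import Relation.Binary.Definitions using (tri<; tri≈; tri>)
open import Relation.Binary.PropositionalEquality hiding ([_])
open import Relation.Nullary using (¬_; Dec; yes; no)

open ≡-Reasoning

private variable
  A B : Set

T⇒≡true : ∀ {b} → T b → b ≡ true
T⇒≡true = Equivalence.to T-≡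

≡true⇒T : ∀ {b} → b ≡ true → T b
≡true⇒T = Equivalence.from T-≡


∧-trueˡ : ∀ {a b} → (a ∧ b) ≡ true → a ≡ true
∧-trueˡ {true} _ = refl

∧-trueʳ : ∀ {a b} → (a ∧ b) ≡ true → b ≡ true
∧-trueʳ {true} e = e

∨-true : ∀ {a b} → (a ∨ b) ≡ true → a ≡ true ⊎ b ≡ true
∨-true {true} _ = inj₁ refl
∨-true {false} e = inj₂ e

not-true : ∀ {b} → not b ≡ true → b ≡ false
not-true {false} _ = refl

not-false : ∀ {b} → b ≡ false → not b ≡ true
not-false refl = refl

true≢false : true ≢ false
true≢false ()

≢true⇒≡false : ∀ {b} → b ≢ true → b ≡ false
≢true⇒≡false {false} _ = refl
≢true⇒≡false {true} b≢true = ⊥-elim (b≢true refl)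

¬T⇒≡false : ∀ {b} → ¬ T b → b ≡ false
¬T⇒≡false ¬t = ≢true⇒≡false (¬t ∘ ≡true⇒T)

≡ᵇ-sound : ∀ m n → (m ≡ᵇ n) ≡ true → m ≡ n
≡ᵇ-sound m n e = ≡ᵇ⇒≡ m n (≡true⇒T e)

≡ᵇ-complete : ∀ {m n} → m ≡ n → (m ≡ᵇ n) ≡ true
≡ᵇ-complete {m} {n} e = T⇒≡true (≡⇒≡ᵇ m n e)

≡ᵇ-false : ∀ {m n} → m ≢ n → (m ≡ᵇ n) ≡ false
≡ᵇ-false {m} {n} m≢n = ¬T⇒≡false (m≢n ∘ ≡ᵇ⇒≡ m n)

<ᵇ-complete : ∀ {m n} → m < n → (m <ᵇ n) ≡ true
<ᵇ-complete = T⇒≡true ∘ <⇒<ᵇ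

<ᵇ-false : ∀ {m n} → ¬ m < n → (m <ᵇ n) ≡ false
<ᵇ-false {m} {n} m≮n = ¬T⇒≡false (m≮n ∘ <ᵇ⇒< m n)

≤ᵇ-sound : ∀ m n → (m ≤ᵇ n) ≡ true → m ≤ n
≤ᵇ-sound m n e = ≤ᵇ⇒≤ m n (≡true⇒T e)

≤ᵇ-complete : ∀ {m n} → m ≤ n → (m ≤ᵇ n) ≡ true
≤ᵇ-complete = T⇒≡true ∘ ≤⇒≤ᵇ

≤ᵇ-false : ∀ {m n} → ¬ m ≤ n → (m ≤ᵇ n) ≡ false
≤ᵇ-false {m} {n} m≰n = ¬T⇒≡false (m≰n ∘ ≤ᵇ⇒≤ m n)

module _ {n : ℕ} where

  ==F-sound : ∀ (x y : Fin n) → (x ==F y) ≡ true → x ≡ y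
  ==F-sound x y e = toℕ-injective (≡ᵇ-sound (toℕ x) (toℕ y) e)

  ==F-refl : ∀ (x : Fin n) → (x ==F x) ≡ true
  ==F-refl x = ≡ᵇ-complete {toℕ x} refl

  ==F-false : ∀ {x y : Fin n} → x ≢ y → (x ==F y) ≡ false
  ==F-false x≢y = ≡ᵇ-false (x≢y ∘ toℕ-injective)

module _ (p : A → Bool) where

  any-true⁺ : ∀ {xs x} → x ∈ xs → p x ≡ true → any p xs ≡ true
  any-true⁺ {x ∷ _} (here refl) px rewrite px = refl
  any-true⁺ {y ∷ _} (there x∈xs) px with p y
  ... | true = refl
  ... | false = any-true⁺ x∈xs px

  any-true⁻ : ∀ xs → any p xs ≡ true → Σ[ x ∈ A ] x ∈ xs × p x ≡ true
  any-true⁻ (x ∷ xs) e with p x in px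
  ... | true = x , here refl , px
  ... | false with y , y∈xs , py ← any-true⁻ xs e = y , there y∈xs , py

  any-false⁺ : ∀ xs → (∀ {x} → x ∈ xs → p x ≡ false) → any p xs ≡ false
  any-false⁺ [] _ = refl
  any-false⁺ (x ∷ xs) h rewrite h (here refl) = any-false⁺ xs (h ∘ there)

  all-true⁺ : ∀ xs → (∀ {x} → x ∈ xs → p x ≡ true) → all p xs ≡ true
  all-true⁺ [] _ = refl
  all-true⁺ (x ∷ xs) h rewrite h (here refl) = all-true⁺ xs (h ∘ there)

  all-true⁻ : ∀ {xs x} → all p xs ≡ true → x ∈ xs → p x ≡ true
  all-true⁻ {y ∷ _} e x∈xs with p y in py
  all-true⁻ e (here refl) | true = py
  all-true⁻ e (there x∈xs) | true = all-true⁻ e x∈xs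

any-cong : ∀ {p q : A → Bool} xs → (∀ x → p x ≡ q x) → any p xs ≡ any q xs
any-cong [] _ = refl
any-cong (x ∷ xs) p≗q = cong₂ _∨_ (p≗q x) (any-cong xs p≗q)

countᵇ : (A → Bool) → List A → ℕ
countᵇ p xs = length (filterᵇ p xs)

bool⇒ℕ : Bool → ℕ
bool⇒ℕ true = 1
bool⇒ℕ false = 0

countᵇ-∷ : ∀ (p : A → Bool) x xs → countᵇ p (x ∷ xs) ≡ bool⇒ℕ (p x) + countᵇ p xs
countᵇ-∷ p x xs with p x
... | true = refl
... | false = refl

module _ {p q : A → Bool} where

  countᵇ-mono : (∀ x → p x ≡ true → q x ≡ true) → ∀ xs → countᵇ p xs ≤ countᵇ q xs
  countᵇ-mono p⇒q [] = z≤n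
  countᵇ-mono p⇒q (x ∷ xs) with p x in px | q x in qx
  ... | true | true = s≤s (countᵇ-mono p⇒q xs)
  ... | true | false = ⊥-elim (true≢false (trans (sym (p⇒q x px)) qx))
  ... | false | true = m≤n⇒m≤1+n (countᵇ-mono p⇒q xs)
  ... | false | false = countᵇ-mono p⇒q xs

  countᵇ-mono-< : (∀ x → p x ≡ true → q x ≡ true) →
    ∀ {xs y} → y ∈ xs → p y ≡ false → q y ≡ true → countᵇ p xs < countᵇ q xs
  countᵇ-mono-< p⇒q {x ∷ xs} (here refl) px qx rewrite px | qx = s≤s (countᵇ-mono p⇒q xs)
  countᵇ-mono-< p⇒q {x ∷ xs} (there y∈xs) py qy with p x in px | q x in qx
  ... | true | true = s≤s (countᵇ-mono-< p⇒q y∈xs py qy)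
  ... | true | false = ⊥-elim (true≢false (trans (sym (p⇒q x px)) qx))
  ... | false | true = m≤n⇒m≤1+n (countᵇ-mono-< p⇒q y∈xs py qy)
  ... | false | false = countᵇ-mono-< p⇒q y∈xs py qy

  countᵇ-∨+∧ : ∀ xs → countᵇ p xs + countᵇ q xs ≡ countᵇ (λ x → p x ∨ q x) xs + countᵇ (λ x → p x ∧ q x) xs
  countᵇ-∨+∧ [] = refl
  countᵇ-∨+∧ (x ∷ xs) = begin
    countᵇ p (x ∷ xs) + countᵇ q (x ∷ xs)
      ≡⟨ cong₂ _+_ (countᵇ-∷ p x xs) (countᵇ-∷ q x xs) ⟩
    (bool⇒ℕ (p x) + countᵇ p xs) + (bool⇒ℕ (q x) + countᵇ q xs)
      ≡⟨ interchange (bool⇒ℕ (p x)) _ _ _ ⟩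
    (bool⇒ℕ (p x) + bool⇒ℕ (q x)) + (countᵇ p xs + countᵇ q xs)
      ≡⟨ cong₂ _+_ (one (p x) (q x)) (countᵇ-∨+∧ xs) ⟩
    (bool⇒ℕ (p x ∨ q x) + bool⇒ℕ (p x ∧ q x)) + (countᵇ ∨pq xs + countᵇ ∧pq xs)
      ≡⟨ interchange (bool⇒ℕ (p x ∨ q x)) _ _ _ ⟩
    (bool⇒ℕ (p x ∨ q x) + countᵇ ∨pq xs) + (bool⇒ℕ (p x ∧ q x) + countᵇ ∧pq xs)
      ≡⟨ sym (cong₂ _+_ (countᵇ-∷ ∨pq x xs) (countᵇ-∷ ∧pq x xs)) ⟩
    countᵇ ∨pq (x ∷ xs) + countᵇ ∧pq (x ∷ xs) ∎
    where
    ∨pq ∧pq : A → Bool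
    ∨pq x = p x ∨ q x
    ∧pq x = p x ∧ q x
    one : ∀ a b → bool⇒ℕ a + bool⇒ℕ b ≡ bool⇒ℕ (a ∨ b) + bool⇒ℕ (a ∧ b)
    one true true = refl
    one true false = refl
    one false true = refl
    one false false = refl

countᵇ-cong : ∀ {p q : A → Bool} → (∀ x → p x ≡ q x) → ∀ xs → countᵇ p xs ≡ countᵇ q xs
countᵇ-cong p≗q xs = ≤-antisym
  (countᵇ-mono (λ x px → trans (sym (p≗q x)) px) xs)
  (countᵇ-mono (λ x qx → trans (p≗q x) qx) xs)

countᵇ-false : ∀ (xs : List A) → countᵇ (λ _ → false) xs ≡ 0
countᵇ-false [] = refl
countᵇ-false (_ ∷ xs) = countᵇ-false xs

countᵇ-true : ∀ (xs : List A) → countᵇ (λ _ → true) xs ≡ length xs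
countᵇ-true [] = refl
countᵇ-true (_ ∷ xs) = cong suc (countᵇ-true xs)

countᵇ-map : ∀ (p : B → Bool) (f : A → B) xs → countᵇ p (map f xs) ≡ countᵇ (p ∘ f) xs
countᵇ-map p f [] = refl
countᵇ-map p f (x ∷ xs) rewrite countᵇ-∷ p (f x) (map f xs) | countᵇ-∷ (p ∘ f) x xs | countᵇ-map p f xs = refl

-- Formal sums Σ q^r M_α: comparing coefficients through cumulative counts

termAtMost : ℕ → List ℕ → ℕ × List ℕ → Bool
termAtMost r α (r′ , α′) = (r′ ≤ᵇ r) ∧ eqListᵇ α′ α

cumulative : QSymℕq → List ℕ → ℕ → ℕ
cumulative s α r = countᵇ (termAtMost r α) s

≤ᵇ-suc-split : ∀ a r → bool⇒ℕ (a ≤ᵇ suc r) ≡ bool⇒ℕ (a ≤ᵇ r) + bool⇒ℕ (a ≡ᵇ suc r)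
≤ᵇ-suc-split zero r = refl
≤ᵇ-suc-split (suc zero) zero = refl
≤ᵇ-suc-split (suc zero) (suc r) = refl
≤ᵇ-suc-split (suc (suc a)) zero = refl
≤ᵇ-suc-split (suc (suc a)) (suc r) = ≤ᵇ-suc-split (suc a) r

coeff-∷ : ∀ a α′ s α r → coeff ((a , α′) ∷ s) α r ≡ bool⇒ℕ ((a ≡ᵇ r) ∧ eqListᵇ α′ α) + coeff s α r
coeff-∷ a α′ s α r = countᵇ-∷ _ (a , α′) s

cumulative-suc : ∀ s α r → cumulative s α (suc r) ≡ cumulative s α r + coeff s α (suc r)
cumulative-suc [] α r = refl
cumulative-suc ((a , α′) ∷ s) α r = begin
  cumulative ((a , α′) ∷ s) α (suc r)
    ≡⟨ countᵇ-∷ (termAtMost (suc r) α) (a , α′) s ⟩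
  bool⇒ℕ ((a ≤ᵇ suc r) ∧ β) + cumulative s α (suc r)
    ≡⟨ cong₂ _+_ (split β) (cumulative-suc s α r) ⟩
  (bool⇒ℕ ((a ≤ᵇ r) ∧ β) + bool⇒ℕ ((a ≡ᵇ suc r) ∧ β)) + (cumulative s α r + coeff s α (suc r))
    ≡⟨ interchange (bool⇒ℕ ((a ≤ᵇ r) ∧ β)) _ _ _ ⟩
  (bool⇒ℕ ((a ≤ᵇ r) ∧ β) + cumulative s α r) + (bool⇒ℕ ((a ≡ᵇ suc r) ∧ β) + coeff s α (suc r))
    ≡⟨ sym (cong₂ _+_ (countᵇ-∷ (termAtMost r α) (a , α′) s) (coeff-∷ a α′ s α (suc r))) ⟩
  cumulative ((a , α′) ∷ s) α r + coeff ((a , α′) ∷ s) α (suc r) ∎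
  where
  β : Bool
  β = eqListᵇ α′ α
  split : ∀ b → bool⇒ℕ ((a ≤ᵇ suc r) ∧ b) ≡ bool⇒ℕ ((a ≤ᵇ r) ∧ b) + bool⇒ℕ ((a ≡ᵇ suc r) ∧ b)
  split true rewrite ∧-identityʳ (a ≤ᵇ suc r) | ∧-identityʳ (a ≤ᵇ r) | ∧-identityʳ (a ≡ᵇ suc r) = ≤ᵇ-suc-split a r
  split false rewrite ∧-zeroʳ (a ≤ᵇ suc r) | ∧-zeroʳ (a ≤ᵇ r) | ∧-zeroʳ (a ≡ᵇ suc r) = refl

cumulative-zero : ∀ s α → cumulative s α 0 ≡ coeff s α 0
cumulative-zero s α = countᵇ-cong (λ { (zero , _) → refl ; (suc _ , _) → refl }) s

≈Q⇒cumulative≡ : ∀ s t → s ≈Q t → ∀ α r → cumulative s α r ≡ cumulative t α r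
≈Q⇒cumulative≡ s t s≈t α zero = trans (cumulative-zero s α) (trans (s≈t α 0) (sym (cumulative-zero t α)))
≈Q⇒cumulative≡ s t s≈t α (suc r) rewrite cumulative-suc s α r | cumulative-suc t α r =
  cong₂ _+_ (≈Q⇒cumulative≡ s t s≈t α r) (s≈t α (suc r))

eqListᵇ-refl : ∀ α → eqListᵇ α α ≡ true
eqListᵇ-refl [] = refl
eqListᵇ-refl (a ∷ α) rewrite ≡ᵇ-complete {a} refl = eqListᵇ-refl α

ranked : (A → ℕ) → (A → List ℕ) → List A → QSymℕq
ranked rank shape = map (λ x → (rank x , shape x))

-- Cumulative counts up to rank f x* separate the two sums.
ranked-≉Q : ∀ (xs : List A) {f g : A → ℕ} (shape : A → List ℕ) → (∀ x → f x ≤ g x) →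
  ∀ {x*} → x* ∈ xs → f x* < g x* → ¬ (ranked f shape xs ≈Q ranked g shape xs)
ranked-≉Q xs {f} {g} shape f≤g {x*} x*∈xs f<g f≈g = <-irrefl (sym same) fewer
  where
  α : List ℕ
  α = shape x*
  r : ℕ
  r = f x*
  same : cumulative (ranked f shape xs) α r ≡ cumulative (ranked g shape xs) α r
  same = ≈Q⇒cumulative≡ (ranked f shape xs) (ranked g shape xs) f≈g α r
  g⇒f : ∀ x → termAtMost r α (g x , shape x) ≡ true → termAtMost r α (f x , shape x) ≡ true
  g⇒f x e = cong₂ _∧_ (≤ᵇ-complete (≤-trans (f≤g x) (≤ᵇ-sound _ _ (∧-trueˡ e)))) (∧-trueʳ e)
  fewer : cumulative (ranked g shape xs) α r < cumulative (ranked f shape xs) α r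
  fewer rewrite countᵇ-map (termAtMost r α) (λ x → (g x , shape x)) xs
              | countᵇ-map (termAtMost r α) (λ x → (f x , shape x)) xs =
    countᵇ-mono-< g⇒f x*∈xs
      (cong (_∧ eqListᵇ α α) (≤ᵇ-false (<⇒≱ f<g)))
      (cong₂ _∧_ (≤ᵇ-complete (≤-refl {r})) (eqListᵇ-refl α))

Edge : ∀ {n} → DecGraph n → Fin n → Fin n → Set
Edge G u v = is-just (wt∣ G u v) ≡ true

_⊆ᴱ_ : ∀ {n} → DecGraph n → DecGraph n → Set
G ⊆ᴱ H = ∀ u v → Edge G u v → Edge H u v

_≡ᴱ_ : ∀ {n} → DecGraph n → DecGraph n → Set
G ≡ᴱ H = ∀ u v → is-just (wt∣ G u v) ≡ is-just (wt∣ H u v)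

module _ {n : ℕ} where

  reachK-mono : ∀ (G H : DecGraph n) → G ⊆ᴱ H → ∀ k u v → reachK G k u v ≡ true → reachK H k u v ≡ true
  reachK-mono G H G⊆H zero u v e = e
  reachK-mono G H G⊆H (suc k) u v e with ∨-true {reachK G k u v} e
  ... | inj₁ r = cong (_∨ any (λ w → reachK H k u w ∧ is-just (wt∣ H w v)) (allFin n)) (reachK-mono G H G⊆H k u v r)
  ... | inj₂ a with any-true⁻ _ (allFin n) a
  ... | w , w∈ , pw with reachK H k u v
  ... | true = refl
  ... | false = any-true⁺ (λ w → reachK H k u w ∧ is-just (wt∣ H w v)) w∈
    (cong₂ _∧_ (reachK-mono G H G⊆H k u w (∧-trueˡ pw)) (G⊆H w v (∧-trueʳ {reachK G k u w} pw)))

  reachK-cong : ∀ {G H : DecGraph n} → G ≡ᴱ H → ∀ k u v → reachK G k u v ≡ reachK H k u v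
  reachK-cong G≡H zero u v = refl
  reachK-cong G≡H (suc k) u v = cong₂ _∨_ (reachK-cong G≡H k u v)
    (any-cong (allFin n) (λ w → cong₂ _∧_ (reachK-cong G≡H k u w) (G≡H w v)))

  reachK-refl : ∀ (G : DecGraph n) k u → reachK G k u u ≡ true
  reachK-refl G zero u = ==F-refl u
  reachK-refl G (suc k) u rewrite reachK-refl G k u = refl

  reachK-edge : ∀ (G : DecGraph n) k {u v} → Edge G u v → reachK G (suc k) u v ≡ true
  reachK-edge G k {u} {v} uv with reachK G k u v
  ... | true = refl
  ... | false = any-true⁺ (λ w → reachK G k u w ∧ is-just (wt∣ G w v)) (∈-allFin u)
    (cong₂ _∧_ (reachK-refl G k u) uv)

  reachK-sink : ∀ (G : DecGraph n) {v} → (∀ w → ¬ Edge G w v) → ∀ k u → reachK G k u v ≡ (u ==F v)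
  reachK-sink G no-in zero u = refl
  reachK-sink G {v} no-in (suc k) u rewrite reachK-sink G no-in k u
    | any-false⁺ (λ w → reachK G k u w ∧ is-just (wt∣ G w v)) (allFin n)
        (λ {w} _ → trans (cong (reachK G k u w ∧_) (¬T⇒≡false (no-in w ∘ T⇒≡true))) (∧-zeroʳ _))
    = ∨-identityʳ _

  reaches-from-below : DecGraph n → Fin n → Bool
  reaches-from-below G v = any (λ u → (toℕ u <ᵇ toℕ v) ∧ vert G u ∧ reachK G n u v) (allFin n)

  -- components G is definitionally countᵇ (isRoot G) (allFin n).
  isRoot : DecGraph n → Fin n → Bool
  isRoot G v = vert G v ∧ not (reaches-from-below G v)

  isRoot-anti : ∀ {G H : DecGraph n} → vert G ≗ vert H → G ⊆ᴱ H → ∀ v → isRoot H v ≡ true → isRoot G v ≡ true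
  isRoot-anti {G} {H} V G⊆H v e rewrite V v =
    cong₂ _∧_ (∧-trueˡ e) (not-false (≢true⇒≡false λ b → true≢false (trans (sym (below-H b)) (not-true (∧-trueʳ e)))))
    where
    below-H : reaches-from-below G v ≡ true → reaches-from-below H v ≡ true
    below-H b with u , u∈ , pu ← any-true⁻ _ (allFin n) b =
      any-true⁺ (λ u → (toℕ u <ᵇ toℕ v) ∧ vert H u ∧ reachK H n u v) u∈
        (cong₂ _∧_ (∧-trueˡ {toℕ u <ᵇ toℕ v} pu) (cong₂ _∧_ (trans (sym (V u)) (∧-trueˡ Gu∧reach))
          (reachK-mono G H G⊆H n u v (∧-trueʳ {vert G u} Gu∧reach))))
      where
      Gu∧reach : (vert G u ∧ reachK G n u v) ≡ true
      Gu∧reach = ∧-trueʳ {toℕ u <ᵇ toℕ v} pu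

  components-anti : ∀ {G H : DecGraph n} → vert G ≗ vert H → G ⊆ᴱ H → components H ≤ components G
  components-anti V G⊆H = countᵇ-mono (isRoot-anti V G⊆H) (allFin n)

  components-cong : ∀ {G H : DecGraph n} → vert G ≗ vert H → G ≡ᴱ H → components G ≡ components H
  components-cong {G} {H} V G≡H = countᵇ-cong same-root (allFin n)
    where
    same-root : ∀ v → isRoot G v ≡ isRoot H v
    same-root v = cong₂ (λ a b → a ∧ not b) (V v) (any-cong (allFin n) λ u →
      cong₂ (λ a b → (toℕ u <ᵇ toℕ v) ∧ a ∧ b) (V u) (reachK-cong G≡H n u v))

  components-anti-< : ∀ {G H : DecGraph n} → vert G ≗ vert H → G ⊆ᴱ H →
    ∀ {v} → isRoot G v ≡ true → isRoot H v ≡ false → components H < components G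
  components-anti-< V G⊆H {v} rootG ¬rootH =
    countᵇ-mono-< (isRoot-anti V G⊆H) (∈-allFin v) ¬rootH rootG

  components-+-< : ∀ {G H : DecGraph n} → (∀ v → isRoot G v ≡ true → isRoot H v ≡ false) →
    ∀ {x} → isRoot G x ≡ false → isRoot H x ≡ false → components G + components H < n
  components-+-< {G} {H} disjoint {x} ¬rootG ¬rootH = subst (_< n) (sym split)
    (≤-trans (countᵇ-mono-< (λ _ _ → refl) (∈-allFin x) (cong₂ _∨_ ¬rootG ¬rootH) refl)
      (≤-reflexive (trans (countᵇ-true (allFin n)) (length-tabulate id))))
    where
    either both : Fin n → Bool
    either v = isRoot G v ∨ isRoot H v
    both v = isRoot G v ∧ isRoot H v
    never : ∀ v → both v ≡ true → false ≡ true
    never v e = ⊥-elim (true≢false (trans (sym (∧-trueʳ {isRoot G v} e)) (disjoint v (∧-trueˡ e))))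
    split : components G + components H ≡ countᵇ either (allFin n)
    split = begin
      components G + components H                         ≡⟨ countᵇ-∨+∧ (allFin n) ⟩
      countᵇ either (allFin n) + countᵇ both (allFin n)   ≡⟨ cong (countᵇ either (allFin n) +_) no-both ⟩
      countᵇ either (allFin n) + 0                        ≡⟨ +-identityʳ _ ⟩
      countᵇ either (allFin n)                            ∎
      where
      no-both : countᵇ both (allFin n) ≡ 0
      no-both = n≤0⇒n≡0 (≤-trans (countᵇ-mono never (allFin n)) (≤-reflexive (countᵇ-false (allFin n))))

∸-monoʳ-<′ : ∀ {n s s′} → s′ < s → s′ < n → n ∸ s < n ∸ s′
∸-monoʳ-<′ {n} {s} s′<s s′<n with s ≤? n
... | yes s≤n = ∸-monoʳ-< s′<s s≤n
... | no s≰n rewrite m≤n⇒m∸n≡0 (<⇒≤ (≰⇒> s≰n)) = m<n⇒0<n∸m s′<n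

sum-map-mono : ∀ {f g : A → ℕ} → (∀ x → f x ≤ g x) → ∀ xs → sum (map f xs) ≤ sum (map g xs)
sum-map-mono f≤g [] = z≤n
sum-map-mono f≤g (x ∷ xs) = +-mono-≤ (f≤g x) (sum-map-mono f≤g xs)

module _ {n : ℕ} where

  layer : DecGraph n → Flag n → ℕ → DecGraph n
  layer G 𝓕 i = contract (induced G (F 𝓕 (suc i))) (F 𝓕 i)

  pr-⊆ᴱ : ∀ {m m′} (B : DecGraph n) → m ≤ m′ → pr m B ⊆ᴱ pr m′ B
  pr-⊆ᴱ {m} {m′} B m≤m′ u v e with vert B u ∧ vert B v
  ... | false = e
  ... | true with wt B u v
  ... | nothing = e
  ... | just d with d ≤ᵇ m in d≤m
  ... | true rewrite ≤ᵇ-complete (≤-trans (≤ᵇ-sound d m d≤m) m≤m′) = refl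

  pr-≡ᴱ-suc : ∀ m (B : DecGraph n) → (∀ u v → wt B u v ≢ just (suc m)) → pr m B ≡ᴱ pr (suc m) B
  pr-≡ᴱ-suc m B no-suc-m u v with vert B u ∧ vert B v
  ... | false = refl
  ... | true with wt B u v in e
  ... | nothing = refl
  ... | just d with d ≤? m
  ... | yes d≤m rewrite ≤ᵇ-complete d≤m | ≤ᵇ-complete (m≤n⇒m≤1+n d≤m) = refl
  ... | no d≰m with d ≟ suc m
  ... | yes refl = ⊥-elim (no-suc-m u v e)
  ... | no d≢1+m rewrite ≤ᵇ-false d≰m | ≤ᵇ-false (λ d≤1+m → d≢1+m (≤-antisym d≤1+m (≰⇒> d≰m))) = refl

  rk-mono : ∀ {m m′} (G : DecGraph n) 𝓕 → m ≤ m′ → rk m G 𝓕 ≤ rk m′ G 𝓕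
  rk-mono G 𝓕 m≤m′ = ∸-monoʳ-≤ n (sum-map-mono
    (λ i → components-anti (λ _ → refl) (pr-⊆ᴱ (layer G 𝓕 i) m≤m′)) (upTo (len 𝓕)))

  rk-suc-≡ : ∀ m (G : DecGraph n) 𝓕 →
    (∀ {i} → i ∈ upTo (len 𝓕) → ∀ u v → wt (layer G 𝓕 i) u v ≢ just (suc m)) →
    rk m G 𝓕 ≡ rk (suc m) G 𝓕
  rk-suc-≡ m G 𝓕 light = cong (λ cs → n ∸ sum cs) (map-cong-local (All.tabulate λ i∈ →
    components-cong (λ _ → refl) (pr-≡ᴱ-suc m (layer G 𝓕 _) (light i∈))))

module _ {n : ℕ} (m : ℕ) (G : DecGraph n) where

  HeavyEdge : Flag n → ℕ → Set
  HeavyEdge 𝓕 i = Σ[ u ∈ Fin n ] Σ[ v ∈ Fin n ] wt (layer G 𝓕 i) u v ≡ just (suc m)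

  heavy? : ∀ 𝓕 i → Dec (HeavyEdge 𝓕 i)
  heavy? 𝓕 i = Finₚ.any? λ u → Finₚ.any? λ v → Maybeₚ.≡-dec _≟_ (wt (layer G 𝓕 i) u v) (just (suc m))

  heavyEdge-or-Ψ≈Q : (Σ[ 𝓕 ∈ Flag n ] Σ[ i ∈ ℕ ] HeavyEdge 𝓕 i) ⊎ (Ψ m G ≈Q Ψ (suc m) G)
  heavyEdge-or-Ψ≈Q with Any.any? (λ 𝓕 → Any.any? (heavy? 𝓕) (upTo (len 𝓕))) (flags n)
  ... | yes some with 𝓕 , in-𝓕 ← Any.satisfied some with i , e ← Any.satisfied in-𝓕 = inj₁ (𝓕 , i , e)
  ... | no none = inj₂ λ α r → cong (λ s → coeff s α r) Ψ≡
    where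
    light : ∀ {𝓕} → 𝓕 ∈ flags n → ∀ {i} → i ∈ upTo (len 𝓕) → ∀ u v → wt (layer G 𝓕 i) u v ≢ just (suc m)
    light 𝓕∈ i∈ u v e = none (lose 𝓕∈ (lose i∈ (u , v , e)))
    Ψ≡ : Ψ m G ≡ Ψ (suc m) G
    Ψ≡ = map-cong-local (All.tabulate λ {𝓕} 𝓕∈ → cong (_, type 𝓕) (rk-suc-≡ m G 𝓕 (light 𝓕∈)))

module UnitWeights {n : ℕ} (w : Fin n → Fin n → Maybe ℕ) (E : Fin n → Fin n → Bool)
  (w-unit : ∀ x y → w x y ≡ (if E x y then just 1 else nothing)) where

  Step : Fin n → Fin n → Set
  Step x y = E x y ≡ true

  WeightIsLength : List (Fin n) → Set
  WeightIsLength ℓ = ∀ {d} → walkWeight w ℓ ≡ just d → Linked Step ℓ × d ≡ length ℓ ∸ 1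

  walkWeight-sound-∷ : ∀ x y ℓ → WeightIsLength (y ∷ ℓ) → WeightIsLength (x ∷ y ∷ ℓ)
  walkWeight-sound-∷ x y ℓ ih e with w x y in wxy | walkWeight w (y ∷ ℓ)
  ... | just a | just b with ih refl | E x y in exy
  ... | walk , refl | true rewrite w-unit x y | exy with refl ← wxy | refl ← e = exy ∷ walk , refl
  ... | _ | false rewrite w-unit x y | exy with () ← wxy
  walkWeight-sound-∷ x y ℓ ih () | just a | nothing
  walkWeight-sound-∷ x y ℓ ih () | nothing | _

  walkWeight-sound : ∀ ℓ → WeightIsLength ℓ
  walkWeight-sound [] refl = [] , refl
  walkWeight-sound (x ∷ []) refl = [-] , refl
  walkWeight-sound (x ∷ y ∷ ℓ) = walkWeight-sound-∷ x y ℓ (walkWeight-sound (y ∷ ℓ))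

  walkWeight-complete : ∀ ℓ → Linked Step ℓ → walkWeight w ℓ ≡ just (length ℓ ∸ 1)
  walkWeight-complete [] [] = refl
  walkWeight-complete (x ∷ []) [-] = refl
  walkWeight-complete (x ∷ y ∷ ℓ) (xy ∷ walk) rewrite w-unit x y | xy | walkWeight-complete (y ∷ ℓ) walk = refl

minM-just : ∀ a b → Σ[ c ∈ ℕ ] minM (just a) (just b) ≡ just c × c ≤ a × c ≤ b × (c ≡ a ⊎ c ≡ b)
minM-just a b with a ≤? b
... | yes a≤b rewrite ≤ᵇ-complete a≤b = a , refl , ≤-refl , a≤b , inj₁ refl
... | no a≰b rewrite ≤ᵇ-false a≰b = b , refl , <⇒≤ (≰⇒> a≰b) , ≤-refl , inj₂ refl

module MinOver (f : A → Maybe ℕ) where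

  minOver : List A → Maybe ℕ
  minOver xs = foldr minM nothing (map f xs)

  minOver-attained : ∀ xs {d} → minOver xs ≡ just d → Σ[ x ∈ A ] x ∈ xs × f x ≡ just d
  minOver-attained (x ∷ xs) e with f x in fx | minOver xs in rest
  ... | nothing | just b with refl ← e with y , y∈ , fy ← minOver-attained xs rest = y , there y∈ , fy
  ... | just a | nothing with refl ← e = x , here refl , fx
  ... | just a | just b with minM-just a b
  ... | c , mc , _ , _ , inj₁ refl with refl ← trans (sym mc) e = x , here refl , fx
  ... | c , mc , _ , _ , inj₂ refl with refl ← trans (sym mc) e with y , y∈ , fy ← minOver-attained xs rest =
    y , there y∈ , fy
  minOver-attained (x ∷ xs) () | nothing | nothing

  minOver-≤ : ∀ xs {x d} → x ∈ xs → f x ≡ just d → Σ[ c ∈ ℕ ] minOver xs ≡ just c × c ≤ d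
  minOver-≤ (x ∷ xs) {d = d} (here refl) fx rewrite fx with minOver xs
  ... | nothing = d , refl , ≤-refl
  ... | just b with c , mc , c≤d , _ ← minM-just d b = c , mc , c≤d
  minOver-≤ (y ∷ xs) (there x∈) fx with minOver-≤ xs x∈ fx
  ... | c , mc , c≤d rewrite mc with f y
  ... | nothing = c , refl , c≤d
  ... | just a with c′ , mc′ , _ , c′≤c , _ ← minM-just a c = c′ , mc′ , ≤-trans c′≤c c≤d

  minOver-lower : ∀ xs {d x d′} → minOver xs ≡ just d → x ∈ xs → f x ≡ just d′ → d ≤ d′
  minOver-lower xs e x∈ fx with c , mc , c≤d′ ← minOver-≤ xs x∈ fx with refl ← trans (sym e) mc = c≤d′

module _ {n : ℕ} where

  distinct⇒Unique : ∀ (xs : List (Fin n)) → distinct xs ≡ true → Unique xs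
  distinct⇒Unique [] _ = []
  distinct⇒Unique (x ∷ xs) d = All.tabulate x∉xs ∷ distinct⇒Unique xs (∧-trueʳ d)
    where
    x∉xs : ∀ {y} → y ∈ xs → x ≢ y
    x∉xs y∈ refl = true≢false (trans (sym (any-true⁺ (x ==F_) y∈ (==F-refl x))) (not-true (∧-trueˡ d)))

  Unique⇒distinct : ∀ {xs : List (Fin n)} → Unique xs → distinct xs ≡ true
  Unique⇒distinct [] = refl
  Unique⇒distinct {x ∷ xs} (x∉xs ∷ u) =
    cong₂ _∧_ (not-false (any-false⁺ (x ==F_) xs (==F-false ∘ All.lookup x∉xs))) (Unique⇒distinct u)

  listsOfLen-complete : ∀ (xs : List (Fin n)) → xs ∈ listsOfLen n (length xs)
  listsOfLen-complete [] = here refl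
  listsOfLen-complete (x ∷ xs) =
    ∈-concatMap⁺ _ (Any.map (λ { refl → ∈-map⁺ (x ∷_) (listsOfLen-complete xs) }) (∈-allFin x))

  interiors-complete : ∀ {xs : List (Fin n)} → Unique xs → length xs ≤ n → xs ∈ interiors n
  interiors-complete {xs} u len≤n = ∈-filter⁺ (T? ∘ distinct)
    (∈-concatMap⁺ (listsOfLen n) (Any.map (λ { refl → listsOfLen-complete xs }) (∈-upTo⁺ (s≤s len≤n))))
    (≡true⇒T (Unique⇒distinct u))

  interiors-sound : ∀ {xs : List (Fin n)} → xs ∈ interiors n → Unique xs
  interiors-sound {xs} xs∈ = distinct⇒Unique xs (T⇒≡true (proj₂ (∈-filter⁻ (T? ∘ distinct) {xs = concatMap (listsOfLen n) (upTo (suc n))} xs∈)))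

allFuns-complete : ∀ k n (f : Fin n → Fin k) → Σ[ g ∈ (Fin n → Fin k) ] g ∈ allFuns k n × g ≗ f
allFuns-complete k zero f = _ , here refl , λ ()
allFuns-complete k (suc n) f with g , g∈ , g≗f ← allFuns-complete k n (f ∘ Fin.suc) =
  _ , ∈-concatMap⁺ _ (Any.map (λ { refl → ∈-map⁺ _ (∈-allFin (f Fin.zero)) }) g∈) ,
  λ { Fin.zero → refl ; (Fin.suc i) → g≗f i }

flag-complete : ∀ n k (f : Fin n → Fin k) → (∀ j → Σ[ i ∈ Fin n ] f i ≡ j) → k ≤ n →
  Σ[ g ∈ (Fin n → Fin k) ] flag k g ∈ flags n × g ≗ f
flag-complete n k f f-onto k≤n with g , g∈ , g≗f ← allFuns-complete k n f = g , listed , g≗f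
  where
  g-onto : surjective g ≡ true
  g-onto = all-true⁺ _ (allFin k) λ {j} _ → let (i , fi≡j) = f-onto j in
    any-true⁺ (λ i → g i ==F j) (∈-allFin i) (≡ᵇ-complete (cong toℕ (trans (g≗f i) fi≡j)))
  listed : flag k g ∈ flags n
  listed = ∈-concatMap⁺ _ (Any.map (λ { refl → ∈-map⁺ (flag k) (∈-filter⁺ (T? ∘ surjective) g∈ (≡true⇒T g-onto)) })
    (∈-upTo⁺ (s≤s k≤n)))

nth : List A → ℕ → A → A
nth [] i d = d
nth (x ∷ xs) zero d = x
nth (x ∷ xs) (suc i) d = nth xs i d

split-at : ∀ (ℓ : List A) j d → j < length ℓ →
  Σ[ M ∈ List A ] Σ[ Q ∈ List A ] ℓ ≡ M ++ nth ℓ j d ∷ Q × length M ≡ j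
split-at (x ∷ ℓ) zero d _ = [] , ℓ , refl , refl
split-at (x ∷ ℓ) (suc j) d (s≤s j<) with M , Q , e , len ← split-at ℓ j d j< = x ∷ M , Q , cong (x ∷_) e , cong suc len

split-at-two : ∀ (ℓ : List A) {i j} d → i < j → j < length ℓ →
  Σ[ P ∈ List A ] Σ[ M ∈ List A ] Σ[ Q ∈ List A ]
    ℓ ≡ P ++ nth ℓ i d ∷ M ++ nth ℓ j d ∷ Q × length M ≡ j ∸ suc i
split-at-two (x ∷ ℓ) {zero} {suc j} d _ (s≤s j<) with M , Q , e , len ← split-at ℓ j d j< =
  [] , M , Q , cong (x ∷_) e , len
split-at-two (x ∷ ℓ) {suc i} {suc j} d (s≤s i<j) (s≤s j<) with P , M , Q , e , len ← split-at-two ℓ d i<j j< =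
  x ∷ P , M , Q , cong (x ∷_) e , len

module _ {R : A → A → Set} where

  Linked-step : ∀ P {a c} Q → Linked R (P ++ a ∷ c ∷ Q) → R a c
  Linked-step [] Q (r ∷ _) = r
  Linked-step (x ∷ []) Q (_ ∷ walk) = Linked-step [] Q walk
  Linked-step (x ∷ y ∷ P) Q (_ ∷ walk) = Linked-step (y ∷ P) Q walk

  Linked-++⁻ʳ : ∀ P {ys} → Linked R (P ++ ys) → Linked R ys
  Linked-++⁻ʳ [] walk = walk
  Linked-++⁻ʳ (x ∷ P) walk = Linked-++⁻ʳ P (Linked.tail walk)

  Linked-prefix : ∀ P {a} ys → Linked R (P ++ a ∷ ys) → Linked R (P ++ [ a ])
  Linked-prefix [] ys _ = [-]
  Linked-prefix (x ∷ []) ys (r ∷ _) = r ∷ [-]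
  Linked-prefix (x ∷ y ∷ P) ys (r ∷ walk) = r ∷ Linked-prefix (y ∷ P) ys walk

  Linked-join : ∀ P {a c} Q → Linked R (P ++ [ a ]) → R a c → Linked R (c ∷ Q) → Linked R (P ++ a ∷ c ∷ Q)
  Linked-join [] Q _ r walk = r ∷ walk
  Linked-join (x ∷ []) Q (r₁ ∷ _) r walk = r₁ ∷ r ∷ walk
  Linked-join (x ∷ y ∷ P) Q (r₁ ∷ walk₁) r walk = r₁ ∷ Linked-join (y ∷ P) Q walk₁ r walk

  Linked-shortcut : ∀ P {a c} M Q → Linked R (P ++ a ∷ M ++ c ∷ Q) → R a c → Linked R (P ++ a ∷ c ∷ Q)
  Linked-shortcut P {a} {c} M Q walk r = Linked-join P Q (Linked-prefix P (M ++ c ∷ Q) walk) r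
    (Linked-++⁻ʳ (P ++ a ∷ M) (subst (Linked R) (sym (++-assoc P (a ∷ M) (c ∷ Q))) walk))

ChordSplit : List A → A → List A → A → List A → A → List A → A → Set
ChordSplit {A} P a M c Q u xs v =
  Σ[ A₁ ∈ List A ] Σ[ B₁ ∈ List A ] (P ++ [ a ] ≡ u ∷ A₁) × (c ∷ Q ≡ B₁ ++ [ v ]) × (xs ≡ A₁ ++ M ++ B₁)

chord-split-∷ʳ : ∀ (P : List A) a M c Q u xs v B₁ w → c ∷ Q ≡ B₁ ++ [ w ] →
  P ++ a ∷ M ++ c ∷ Q ≡ u ∷ xs ++ [ v ] → ChordSplit P a M c Q u xs v
chord-split-∷ʳ [] a M c Q u xs v B₁ w cQ≡ e with refl ← ∷-injectiveˡ e
  with xs≡ , refl ← ∷ʳ-injective (M ++ B₁) xs (begin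
    (M ++ B₁) ++ [ w ] ≡⟨ ++-assoc M B₁ [ w ] ⟩
    M ++ B₁ ++ [ w ]   ≡⟨ cong (M ++_) cQ≡ ⟨
    M ++ c ∷ Q         ≡⟨ ∷-injectiveʳ e ⟩
    xs ++ [ v ]        ∎)
  = [] , B₁ , refl , cQ≡ , sym xs≡
chord-split-∷ʳ (y ∷ P) a M c Q u xs v B₁ w cQ≡ e with refl ← ∷-injectiveˡ e
  with xs≡ , refl ← ∷ʳ-injective (P ++ a ∷ M ++ B₁) xs (begin
    (P ++ a ∷ M ++ B₁) ++ [ w ] ≡⟨ ++-assoc P (a ∷ M ++ B₁) [ w ] ⟩
    P ++ a ∷ (M ++ B₁) ++ [ w ] ≡⟨ cong (λ z → P ++ a ∷ z) (++-assoc M B₁ [ w ]) ⟩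
    P ++ a ∷ M ++ B₁ ++ [ w ]   ≡⟨ cong (λ z → P ++ a ∷ M ++ z) cQ≡ ⟨
    P ++ a ∷ M ++ c ∷ Q         ≡⟨ ∷-injectiveʳ e ⟩
    xs ++ [ v ]                 ∎)
  = P ++ [ a ] , B₁ , refl , cQ≡ , trans (sym xs≡) (sym (++-assoc P [ a ] (M ++ B₁)))

chord-split : ∀ (P : List A) a M c Q u xs v → P ++ a ∷ M ++ c ∷ Q ≡ u ∷ xs ++ [ v ] →
  ChordSplit P a M c Q u xs v
chord-split P a M c Q u xs v e = via (initLast (c ∷ Q)) refl
  where
  via : ∀ {zs} → InitLast zs → zs ≡ c ∷ Q → ChordSplit P a M c Q u xs v
  via (B₁ ∷ʳ′ w) zs≡ = chord-split-∷ʳ P a M c Q u xs v B₁ w (sym zs≡) e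

∈-drop-middle : ∀ (A₁ M : List A) {B₁ y} → y ∈ A₁ ++ B₁ → y ∈ A₁ ++ M ++ B₁
∈-drop-middle A₁ M y∈ with ∈-++⁻ A₁ y∈
... | inj₁ y∈A₁ = ∈-++⁺ˡ y∈A₁
... | inj₂ y∈B₁ = ∈-++⁺ʳ A₁ (∈-++⁺ʳ M y∈B₁)

Unique-drop-middle : ∀ (A₁ M : List A) {B₁} → Unique (A₁ ++ M ++ B₁) → Unique (A₁ ++ B₁)
Unique-drop-middle [] [] u = u
Unique-drop-middle [] (x ∷ M) (_ ∷ u) = Unique-drop-middle [] M u
Unique-drop-middle (x ∷ A₁) M (x∉ ∷ u) = All.++⁺ (All.++⁻ˡ A₁ x∉) (All.++⁻ʳ M (All.++⁻ʳ A₁ x∉)) ∷ Unique-drop-middle A₁ M u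

Unique-no-repeat : ∀ (P : List A) a M Q → ¬ Unique (P ++ a ∷ M ++ a ∷ Q)
Unique-no-repeat [] a M Q (a∉ ∷ _) = All.lookup a∉ (∈-++⁺ʳ M (here refl)) refl
Unique-no-repeat (x ∷ P) a M Q (_ ∷ u) = Unique-no-repeat P a M Q u

-- Chordless Hamiltonian paths

injective⇒surjective : ∀ {n} (g : Fin n → Fin n) → (∀ {i j} → g i ≡ g j → i ≡ j) → ∀ y → Σ[ i ∈ Fin n ] g i ≡ y
injective⇒surjective {suc n} g g-inj y with Finₚ.any? (λ i → g i Finₚ.≟ y)
... | yes hit = hit
... | no miss = ⊥-elim (1+n≰n (Finₚ.injective⇒≤ squeeze-injective))
  where
  squeeze : Fin (suc n) → Fin n
  squeeze i = punchOut {i = y} {j = g i} (λ y≡gi → miss (i , sym y≡gi))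
  squeeze-injective : ∀ {i j} → squeeze i ≡ squeeze j → i ≡ j
  squeeze-injective {i} {j} e = g-inj (Finₚ.punchOut-injective {i = y} _ _ e)

≅-from-injective : ∀ {n} (Γ Δ : SimpleGraph n) (g : Fin n → Fin n) → (∀ {i j} → g i ≡ g j → i ≡ j) →
  (∀ i j → adj Γ (g i) (g j) ≡ adj Δ i j) → Γ ≅ Δ
≅-from-injective {n} Γ Δ g g-inj g-adj = mk↔ₛ′ g⁻¹ g (λ i → g-inj (g∘g⁻¹ (g i))) g∘g⁻¹ , preserves
  where
  g⁻¹ : Fin n → Fin n
  g⁻¹ y = proj₁ (injective⇒surjective g g-inj y)
  g∘g⁻¹ : ∀ y → g (g⁻¹ y) ≡ y
  g∘g⁻¹ y = proj₂ (injective⇒surjective g g-inj y)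
  preserves : ∀ u v → adj Γ u v ≡ adj Δ (g⁻¹ u) (g⁻¹ v)
  preserves u v = trans (sym (cong₂ (adj Γ) (g∘g⁻¹ u) (g∘g⁻¹ v))) (g-adj (g⁻¹ u) (g⁻¹ v))

module _ {n : ℕ} (Γ : SimpleGraph n) where

  Adjacent : Fin n → Fin n → Set
  Adjacent x y = adj Γ x y ≡ true

  Chordless : List (Fin n) → Set
  Chordless ℓ = ∀ P a M c Q → ℓ ≡ P ++ a ∷ M ++ c ∷ Q → 1 ≤ length M → adj Γ a c ≡ false

  hamiltonianPath⇒≅L : ∀ (ℓ : List (Fin n)) d → length ℓ ≡ n → Unique ℓ → Linked Adjacent ℓ → Chordless ℓ → Γ ≅ L n
  hamiltonianPath⇒≅L ℓ d len≡n unique walk chordless = ≅-from-injective Γ (L n) g g-injective adj-g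
    where
    g : Fin n → Fin n
    g i = nth ℓ (toℕ i) d

    in-range : ∀ (j : Fin n) → toℕ j < length ℓ
    in-range j = subst (toℕ j <_) (sym len≡n) (toℕ<n j)

    adj-g-< : ∀ i j → toℕ i < toℕ j → adj Γ (g i) (g j) ≡ adj (L n) i j
    adj-g-< i j i<j with split-at-two ℓ d i<j (in-range j) | toℕ j ≟ suc (toℕ i)
    ... | P , [] , Q , split , _ | yes j≡ rewrite ≡ᵇ-complete (sym j≡) =
      Linked-step P Q (subst (Linked Adjacent) split walk)
    ... | P , _ ∷ _ , Q , _ , len | yes j≡ rewrite j≡ | n∸n≡0 (toℕ i) with () ← len
    ... | P , M , Q , split , len | no j≢
      rewrite ≡ᵇ-false (j≢ ∘ sym) | ≡ᵇ-false {suc (toℕ j)} {toℕ i} (λ e → <-asym i<j (subst (toℕ j <_) e (n<1+n (toℕ j)))) =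
      chordless P (g i) M (g j) Q split (subst (1 ≤_) (sym len) (m<n⇒0<n∸m (≤∧≢⇒< i<j (j≢ ∘ sym))))

    no-repeat : ∀ i j → toℕ i < toℕ j → g i ≢ g j
    no-repeat i j i<j e with P , M , Q , split , _ ← split-at-two ℓ d i<j (in-range j) rewrite e =
      Unique-no-repeat P (g j) M Q (subst Unique split unique)

    g-injective : ∀ {i j} → g i ≡ g j → i ≡ j
    g-injective {i} {j} e with <-cmp (toℕ i) (toℕ j)
    ... | tri< i<j _ _ = ⊥-elim (no-repeat i j i<j e)
    ... | tri≈ _ i≡j _ = toℕ-injective i≡j
    ... | tri> _ _ j<i = ⊥-elim (no-repeat j i j<i (sym e))

    adj-g : ∀ i j → adj Γ (g i) (g j) ≡ adj (L n) i j
    adj-g i j with <-cmp (toℕ i) (toℕ j)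
    ... | tri< i<j _ _ = adj-g-< i j i<j
    ... | tri≈ _ i≡j _ rewrite toℕ-injective {i = i} {j} i≡j = trans (irrefl Γ (g j)) (sym (irrefl (L n) j))
    ... | tri> _ _ j<i = trans (SimpleGraph.sym Γ (g i) (g j)) (trans (adj-g-< j i j<i) (SimpleGraph.sym (L n) j i))

Unique-walk : ∀ {xs : List A} {u v} → Unique xs → (∀ {y} → y ∈ xs → u ≢ y) → (∀ {y} → y ∈ xs → y ≢ v) → u ≢ v →
  Unique (u ∷ xs ++ [ v ])
Unique-walk unique u∉ v∉ u≢v =
  All.++⁺ (All.tabulate u∉) (u≢v ∷ []) ∷ AllPairs.++⁺ unique (All.[] ∷ []) (All.tabulate λ y∈ → v∉ y∈ ∷ [])

length-drop-middle-< : ∀ (A₁ M B₁ : List A) → 1 ≤ length M → length (A₁ ++ B₁) < length (A₁ ++ M ++ B₁)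
length-drop-middle-< A₁ M B₁ 1≤M rewrite length-++ A₁ {B₁} | length-++ A₁ {M ++ B₁} | length-++ M {B₁} =
  +-monoʳ-< (length A₁) (m<n+m (length B₁) 1≤M)

walk-weight : ∀ (u : A) xs v → length (u ∷ xs ++ [ v ]) ∸ 1 ≡ suc (length xs)
walk-weight u xs v = trans (length-++ xs) (+-comm (length xs) 1)

module Contraction {n : ℕ} (Γ : SimpleGraph n) (S′ S : Fin n → Bool) where

  IG : DecGraph n
  IG = induced (deco1 Γ) S′

  E : Fin n → Fin n → Bool
  E x y = S′ x ∧ S′ y ∧ adj Γ x y

  wt∣IG-unit : ∀ x y → wt∣ IG x y ≡ (if E x y then just 1 else nothing)
  wt∣IG-unit x y with S′ x | S′ y | adj Γ x y
  ... | true | true | true = refl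
  ... | true | true | false = refl
  ... | true | false | _ = refl
  ... | false | _ | _ = refl

  open UnitWeights (wt∣ IG) E wt∣IG-unit public

  Inside : Fin n → Bool
  Inside x = S x ∧ vert IG x

  pathWeight : Fin n → Fin n → List (Fin n) → Maybe ℕ
  pathWeight u v xs = if all Inside xs then walkWeight (wt∣ IG) (u ∷ xs ++ [ v ]) else nothing

  open MinOver public

  Endpoints : Fin n → Fin n → Bool
  Endpoints u v = (S′ u ∧ not (S u)) ∧ (S′ v ∧ not (S v)) ∧ not (u ==F v)

  pathWeight-just : ∀ u v xs {d} → pathWeight u v xs ≡ just d →
    all Inside xs ≡ true × walkWeight (wt∣ IG) (u ∷ xs ++ [ v ]) ≡ just d
  pathWeight-just u v xs e with all Inside xs
  ... | true = refl , e

  pathWeight-inside : ∀ u v xs → all Inside xs ≡ true → pathWeight u v xs ≡ walkWeight (wt∣ IG) (u ∷ xs ++ [ v ])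
  pathWeight-inside u v xs inside rewrite inside = refl

  admissible-weight : ∀ u v ys → all Inside ys ≡ true → Linked Step (u ∷ ys ++ [ v ]) →
    pathWeight u v ys ≡ just (suc (length ys))
  admissible-weight u v ys inside walk =
    trans (pathWeight-inside u v ys inside) (trans (walkWeight-complete _ walk) (cong just (walk-weight u ys v)))

  Edge-pr⁺ : ∀ k {u v} → Endpoints u v ≡ true → ∀ {c} → minOver (pathWeight u v) (interiors n) ≡ just c → c ≤ k →
    Edge (pr k (contract IG S)) u v
  Edge-pr⁺ k {u} {v} ends min≡ c≤k with S′ u ∧ not (S u) | S′ v ∧ not (S v) | u ==F v
  ... | true | true | false rewrite min≡ | ≤ᵇ-complete c≤k = refl

  Edge-pr⁻ : ∀ k {u v} → Edge (pr k (contract IG S)) u v →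
    Endpoints u v ≡ true × Σ[ c ∈ ℕ ] minOver (pathWeight u v) (interiors n) ≡ just c × c ≤ k
  Edge-pr⁻ k {u} {v} e with S′ u ∧ not (S u) | S′ v ∧ not (S v) | u ==F v | minOver (pathWeight u v) (interiors n)
  ... | true | true | false | just c with c ≤ᵇ k in c≤k
  ... | true = refl , c , refl , ≤ᵇ-sound c k c≤k

  Endpoints-sound : ∀ {u v} → Endpoints u v ≡ true →
    vert (contract IG S) u ≡ true × vert (contract IG S) v ≡ true × u ≢ v
  Endpoints-sound {u} {v} ends with S′ u ∧ not (S u) | S′ v ∧ not (S v) | u ==F v in u==v
  ... | true | true | false = refl , refl , λ { refl → true≢false (trans (sym (==F-refl u)) u==v) }

  Endpoints-complete : ∀ {u v} → vert (contract IG S) u ≡ true → vert (contract IG S) v ≡ true → u ≢ v →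
    Endpoints u v ≡ true
  Endpoints-complete endu endv u≢v rewrite endu | endv | ==F-false u≢v = refl

  -- An admissible walk of length n - 1 between the ends of a contracted edge of weight n - 1
  -- must be chordless and pass through every vertex.
  module Heavy (u v : Fin n) (k : ℕ) (n≡ : n ≡ suc (suc k)) (ends : Endpoints u v ≡ true)
    (heaviest : minOver (pathWeight u v) (interiors n) ≡ just (suc k)) where

    endu : vert (contract IG S) u ≡ true
    endu = proj₁ (Endpoints-sound ends)
    endv : vert (contract IG S) v ≡ true
    endv = proj₁ (proj₂ (Endpoints-sound ends))
    u≢v : u ≢ v
    u≢v = proj₂ (proj₂ (Endpoints-sound ends))

    S′u : S′ u ≡ true
    S′u = ∧-trueˡ endu
    ¬Su : S u ≡ false
    ¬Su = not-true (∧-trueʳ {S′ u} endu)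
    S′v : S′ v ≡ true
    S′v = ∧-trueˡ endv
    ¬Sv : S v ≡ false
    ¬Sv = not-true (∧-trueʳ {S′ v} endv)

    admissible-long : ∀ ys → all Inside ys ≡ true → Unique ys → length ys ≤ n → Linked Step (u ∷ ys ++ [ v ]) →
      k ≤ length ys
    admissible-long ys inside unique len≤n walk = ≤-pred (minOver-lower (pathWeight u v) (interiors n) heaviest
      (interiors-complete unique len≤n) (admissible-weight u v ys inside walk))

    shortest : Σ[ xs ∈ List (Fin n) ] xs ∈ interiors n × pathWeight u v xs ≡ just (suc k)
    shortest = minOver-attained (pathWeight u v) (interiors n) heaviest

    xs : List (Fin n)
    xs = proj₁ shortest

    ℓ : List (Fin n)
    ℓ = u ∷ xs ++ [ v ]

    xs-inside : all Inside xs ≡ true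
    xs-inside = proj₁ (pathWeight-just u v xs (proj₂ (proj₂ shortest)))

    ℓ-walk : Linked Step ℓ × suc k ≡ length ℓ ∸ 1
    ℓ-walk = walkWeight-sound ℓ (proj₂ (pathWeight-just u v xs (proj₂ (proj₂ shortest))))

    length-xs : length xs ≡ k
    length-xs = suc-injective (trans (sym (walk-weight u xs v)) (sym (proj₂ ℓ-walk)))

    length-ℓ : length ℓ ≡ n
    length-ℓ = trans (cong suc (length-++ xs)) (trans (cong suc (+-comm (length xs) 1)) (trans (cong (suc ∘ suc) length-xs) (sym n≡)))

    S-xs : ∀ {y} → y ∈ xs → S y ≡ true
    S-xs y∈ = ∧-trueˡ (all-true⁻ Inside xs-inside y∈)

    S′-ℓ : ∀ {y} → y ∈ ℓ → S′ y ≡ true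
    S′-ℓ (here refl) = S′u
    S′-ℓ (there y∈) with ∈-++⁻ xs y∈
    ... | inj₁ y∈xs = ∧-trueʳ {S _} (all-true⁻ Inside xs-inside y∈xs)
    ... | inj₂ (here refl) = S′v

    ℓ-unique : Unique ℓ
    ℓ-unique = Unique-walk (interiors-sound (proj₁ (proj₂ shortest)))
      (λ y∈ u≡y → true≢false (trans (sym (S-xs y∈)) (trans (cong S (sym u≡y)) ¬Su)))
      (λ y∈ y≡v → true≢false (trans (sym (S-xs y∈)) (trans (cong S y≡v) ¬Sv)))
      u≢v

    ℓ-chordless : Chordless Γ ℓ
    ℓ-chordless P a M c Q split 1≤M with adj Γ a c in chord
    ... | false = refl
    ... | true with A₁ , B₁ , start , end , middle ← chord-split P a M c Q u xs v (sym split) =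
      ⊥-elim (<⇒≱ shorter (admissible-long ys ys-inside ys-unique (≤-trans (<⇒≤ shorter) k≤n) ys-walk))
      where
      ys : List (Fin n)
      ys = A₁ ++ B₁
      shorter : length ys < k
      shorter = subst (length ys <_) (trans (cong length (sym middle)) length-xs) (length-drop-middle-< A₁ M B₁ 1≤M)
      k≤n : k ≤ n
      k≤n = subst (k ≤_) (sym n≡) (≤-trans (n≤1+n k) (n≤1+n (suc k)))
      walk : Linked Step (P ++ a ∷ M ++ c ∷ Q)
      walk = subst (Linked Step) split (proj₁ ℓ-walk)
      a∈ℓ : a ∈ ℓ
      a∈ℓ = subst (a ∈_) (sym split) (∈-++⁺ʳ P (here refl))
      c∈ℓ : c ∈ ℓ
      c∈ℓ = subst (c ∈_) (sym split) (∈-++⁺ʳ P (there (∈-++⁺ʳ M (here refl))))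
      step : Step a c
      step = trans (cong₂ (λ x y → x ∧ y ∧ adj Γ a c) (S′-ℓ a∈ℓ) (S′-ℓ c∈ℓ)) chord
      ys-walk : Linked Step (u ∷ ys ++ [ v ])
      ys-walk = subst (Linked Step) shape (Linked-shortcut P M Q walk step)
        where
        shape : P ++ a ∷ c ∷ Q ≡ u ∷ ys ++ [ v ]
        shape = trans (sym (++-assoc P [ a ] (c ∷ Q))) (trans (cong₂ _++_ start end) (cong (u ∷_) (sym (++-assoc A₁ B₁ [ v ]))))
      ys-inside : all Inside ys ≡ true
      ys-inside = all-true⁺ Inside ys λ y∈ → all-true⁻ Inside xs-inside (subst (_ ∈_) (sym middle) (∈-drop-middle A₁ M y∈))
      ys-unique : Unique ys
      ys-unique = Unique-drop-middle A₁ M (subst Unique middle (interiors-sound (proj₁ (proj₂ shortest))))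

    ≅L : Γ ≅ L n
    ≅L = hamiltonianPath⇒≅L Γ ℓ u length-ℓ ℓ-unique
      (Linked.map (λ {x} {y} step → ∧-trueʳ {S′ y} (∧-trueʳ {S′ x} step)) (proj₁ ℓ-walk)) ℓ-chordless

heavyEdge⇒≅L : ∀ {k} (Γ : SimpleGraph (suc (suc k))) S′ S u v →
  wt (contract (induced (deco1 Γ) S′) S) u v ≡ just (suc k) → Γ ≅ L (suc (suc k))
heavyEdge⇒≅L {k} Γ S′ S u v = via-endpoints refl
  where
  open Contraction Γ S′ S
  via-endpoints : ∀ {b} → Endpoints u v ≡ b →
    (if b then minOver (pathWeight u v) (interiors (suc (suc k))) else nothing) ≡ just (suc k) → Γ ≅ L (suc (suc k))
  via-endpoints {true} ends heaviest = Heavy.≅L u v k refl ends heaviest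

Ψ-suc-≉Q⇒≅L : ∀ k (Γ : SimpleGraph (suc (suc k))) → ¬ (Ψ k (deco1 Γ) ≈Q Ψ (suc k) (deco1 Γ)) → Γ ≅ L (suc (suc k))
Ψ-suc-≉Q⇒≅L k Γ Ψ≉ with heavyEdge-or-Ψ≈Q k (deco1 Γ)
... | inj₁ (𝓕 , i , u , v , heavy) = heavyEdge⇒≅L Γ (F 𝓕 (suc i)) (F 𝓕 i) u v heavy
... | inj₂ Ψ≈ = ⊥-elim (Ψ≉ Ψ≈)

-- Separating the Ψ^m on the path L n

L-adj-dist : ∀ a b → ((suc a ≡ᵇ b) ∨ (suc b ≡ᵇ a)) ≡ (∣ a - b ∣ ≡ᵇ 1)
L-adj-dist zero zero = refl
L-adj-dist zero (suc zero) = refl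
L-adj-dist zero (suc (suc b)) = refl
L-adj-dist (suc zero) zero = refl
L-adj-dist (suc (suc a)) zero = refl
L-adj-dist (suc a) (suc b) = L-adj-dist a b

Linked-spread : ∀ (f : A → ℕ) {R : A → A → Set} → (∀ {x y} → R x y → ∣ f x - f y ∣ ≤ 1) →
  ∀ x ws y → Linked R (x ∷ ws ++ [ y ]) → ∣ f x - f y ∣ ≤ suc (length ws)
Linked-spread f near x [] y (r ∷ _) = near r
Linked-spread f near x (z ∷ ws) y (r ∷ walk) =
  ≤-trans (∣-∣-triangle (f x) (f z) (f y)) (+-mono-≤ (near r) (Linked-spread f near z ws y walk))

∣n-1+n∣≡1 : ∀ i → ∣ i - suc i ∣ ≡ 1
∣n-1+n∣≡1 zero = refl
∣n-1+n∣≡1 (suc i) = ∣n-1+n∣≡1 i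

module Separation {n′ : ℕ} (Γ : SimpleGraph (suc n′)) (iso : Γ ≅ L (suc n′))
  (m m′ : ℕ) (1≤m : 1 ≤ m) (m<m′ : m < m′) (m′<n : m′ < suc n′) where

  n : ℕ
  n = suc n′

  σ : Fin n ↔ Fin n
  σ = proj₁ iso

  pos : Fin n → ℕ
  pos x = toℕ (Inverse.to σ x)

  -- out of range positions are junk (reduced mod n); only p ≤ m′ < n is ever used
  at : ℕ → Fin n
  at p = Inverse.from σ (p mod n)

  pos-at : ∀ {p} → p < n → pos (at p) ≡ p
  pos-at {p} p<n = trans (cong toℕ (Inverse.strictlyInverseˡ σ (p mod n))) (trans (Finₚ.toℕ-fromℕ< _) (m<n⇒m%n≡m p<n))

  pos-injective : ∀ {x y} → pos x ≡ pos y → x ≡ y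
  pos-injective {x} {y} e = trans (sym (Inverse.strictlyInverseʳ σ x))
    (trans (cong (Inverse.from σ) (toℕ-injective e)) (Inverse.strictlyInverseʳ σ y))

  adj-pos : ∀ x y → adj Γ x y ≡ (∣ pos x - pos y ∣ ≡ᵇ 1)
  adj-pos x y = trans (proj₂ iso x y) (L-adj-dist (pos x) (pos y))

  isEnd : Fin n → Bool
  isEnd x = (pos x ≡ᵇ 0) ∨ (pos x ≡ᵇ m′)

  endBlock : Fin n → Fin 2
  endBlock x = if isEnd x then Fin.suc Fin.zero else Fin.zero

  2≤m′ : 2 ≤ m′
  2≤m′ = ≤-trans (s≤s 1≤m) m<m′

  isEnd-0 : isEnd (at 0) ≡ true
  isEnd-0 rewrite pos-at {0} (s≤s z≤n) = refl

  isEnd-m′ : isEnd (at m′) ≡ true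
  isEnd-m′ rewrite pos-at m′<n | ≡ᵇ-complete {m′} refl = ∨-comm _ true

  isEnd-inner : ∀ {q} → 1 ≤ q → q < m′ → isEnd (at q) ≡ false
  isEnd-inner {suc q} _ q<m′ rewrite pos-at (<-trans q<m′ m′<n) = ≡ᵇ-false (<⇒≢ q<m′)

  endBlock-onto : ∀ j → Σ[ x ∈ Fin n ] endBlock x ≡ j
  endBlock-onto Fin.zero = at 1 , cong (λ b → if b then Fin.suc Fin.zero else Fin.zero) (isEnd-inner ≤-refl 2≤m′)
  endBlock-onto (Fin.suc Fin.zero) = at 0 , cong (λ b → if b then Fin.suc Fin.zero else Fin.zero) isEnd-0

  2≤n : 2 ≤ n
  2≤n = ≤-trans 2≤m′ (<⇒≤ m′<n)

  at-injective : ∀ {a b} → a < n → b < n → at a ≡ at b → a ≡ b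
  at-injective a<n b<n e = trans (sym (pos-at a<n)) (trans (cong pos e) (pos-at b<n))

  ends-distinct : at 0 ≢ at m′
  ends-distinct e = <⇒≢ (≤-trans (s≤s z≤n) 2≤m′) (at-injective (s≤s z≤n) m′<n e)

  ends-far : ∀ {x y} → isEnd x ≡ true → isEnd y ≡ true → x ≢ y → ∣ pos x - pos y ∣ ≡ m′
  ends-far {x} {y} endx endy x≢y with ∨-true {pos x ≡ᵇ 0} endx | ∨-true {pos y ≡ᵇ 0} endy
  ... | inj₁ x0 | inj₁ y0 = ⊥-elim (x≢y (pos-injective (trans (≡ᵇ-sound (pos x) 0 x0) (sym (≡ᵇ-sound (pos y) 0 y0)))))
  ... | inj₁ x0 | inj₂ ym = cong₂ ∣_-_∣ (≡ᵇ-sound (pos x) 0 x0) (≡ᵇ-sound (pos y) m′ ym)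
  ... | inj₂ xm | inj₁ y0 = trans (cong₂ ∣_-_∣ (≡ᵇ-sound (pos x) m′ xm) (≡ᵇ-sound (pos y) 0 y0)) (∣-∣-identityʳ m′)
  ... | inj₂ xm | inj₂ ym = ⊥-elim (x≢y (pos-injective (trans (≡ᵇ-sound (pos x) m′ xm) (sym (≡ᵇ-sound (pos y) m′ ym)))))

  p : ℕ
  p = m′ ∸ 1

  1+p≡m′ : suc p ≡ m′
  1+p≡m′ = m+[n∸m]≡n (≤-trans (s≤s z≤n) 2≤m′)

  position-< : ∀ {q} → q ≤ suc p → q < n
  position-< q≤1+p = ≤-<-trans (subst (_ ≤_) 1+p≡m′ q≤1+p) m′<n

  module WithFlag (g : Fin n → Fin 2) (g≗ : g ≗ endBlock) where

    𝓕 : Flag n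
    𝓕 = flag 2 g

    G : DecGraph n
    G = deco1 Γ

    F₂ : ∀ v → F 𝓕 2 v ≡ true
    F₂ v = <ᵇ-complete (toℕ<n (g v))

    F₁ : ∀ v → F 𝓕 1 v ≡ not (isEnd v)
    F₁ v rewrite g≗ v with isEnd v
    ... | true = refl
    ... | false = refl

    open Contraction Γ (F 𝓕 2) (F 𝓕 1)

    L₀ L₁ : DecGraph n
    L₀ = layer G 𝓕 0
    L₁ = layer G 𝓕 1

    vert-L₁ : ∀ v → vert L₁ v ≡ isEnd v
    vert-L₁ v rewrite F₂ v | F₁ v = not-involutive (isEnd v)

    step-at : ∀ {a b} → a < n → b < n → ∣ a - b ∣ ≡ 1 → Step (at a) (at b)
    step-at {a} {b} a<n b<n dist = trans (cong₂ (λ x y → x ∧ y ∧ adj Γ (at a) (at b)) (F₂ (at a)) (F₂ (at b)))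
      (trans (adj-pos (at a) (at b)) (≡ᵇ-complete (trans (cong₂ ∣_-_∣ (pos-at a<n) (pos-at b<n)) dist)))

    walks-long : ∀ {x y} → isEnd x ≡ true → isEnd y ≡ true → x ≢ y → ∀ ys {d} → pathWeight x y ys ≡ just d → m′ ≤ d
    walks-long {x} {y} endx endy x≢y ys {d} e = begin-≤
      where
      sound : Linked Step (x ∷ ys ++ [ y ]) × d ≡ length (x ∷ ys ++ [ y ]) ∸ 1
      sound = walkWeight-sound (x ∷ ys ++ [ y ]) (proj₂ (pathWeight-just x y ys e))
      near : ∀ {a b} → Step a b → ∣ pos a - pos b ∣ ≤ 1
      near {a} {b} s = ≤-reflexive (≡ᵇ-sound _ 1 (trans (sym (adj-pos a b)) (∧-trueʳ {F 𝓕 2 b} (∧-trueʳ {F 𝓕 2 a} s))))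
      begin-≤ : m′ ≤ d
      begin-≤ = subst₂ _≤_ (ends-far endx endy x≢y) (sym (trans (proj₂ sound) (walk-weight x ys y)))
        (Linked-spread pos near x ys y (proj₁ sound))

    no-light-edge : ∀ w x → ¬ Edge (pr m L₁) w x
    no-light-edge w x e with ends , c , min≡ , c≤m ← Edge-pr⁻ m e
      with ys , _ , ys≡ ← minOver-attained (pathWeight w x) (interiors n) min≡
      with endw , endx , w≢x ← Endpoints-sound ends =
      <⇒≱ (≤-<-trans c≤m m<m′) (walks-long (trans (sym (vert-L₁ w)) endw) (trans (sym (vert-L₁ x)) endx) w≢x ys ys≡)

    crossing-walk : ∀ {x y} ys → isEnd x ≡ true → isEnd y ≡ true → x ≢ y → (∀ {z} → z ∈ ys → isEnd z ≡ false) →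
      Unique ys → suc (length ys) ≡ m′ → Linked Step (x ∷ ys ++ [ y ]) → Edge (pr m′ L₁) x y
    crossing-walk {x} {y} ys endx endy x≢y inner unique len walk =
      via (minOver-≤ (pathWeight x y) (interiors n) (interiors-complete unique len≤n) (admissible-weight x y ys inside walk))
      where
      len≤n : length ys ≤ n
      len≤n = ≤-trans (n≤1+n _) (≤-trans (≤-reflexive len) (<⇒≤ m′<n))
      inside : all Inside ys ≡ true
      inside = all-true⁺ Inside ys λ {z} z∈ → cong₂ _∧_ (trans (F₁ z) (cong not (inner z∈))) (F₂ z)
      via : Σ[ c ∈ ℕ ] minOver (pathWeight x y) (interiors n) ≡ just c × c ≤ suc (length ys) → Edge (pr m′ L₁) x y
      via (c , min≡ , c≤) =
        Edge-pr⁺ m′ (Endpoints-complete (trans (vert-L₁ x) endx) (trans (vert-L₁ y) endy) x≢y) min≡ (subst (c ≤_) len c≤)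

    ys-up : List (Fin n)
    ys-up = applyUpTo (at ∘ suc) p

    ys-down : List (Fin n)
    ys-down = applyDownFrom (at ∘ suc) p

    inner-position : ∀ {i} → i < p → isEnd (at (suc i)) ≡ false
    inner-position i<p = isEnd-inner (s≤s z≤n) (subst (_ <_) 1+p≡m′ (s≤s i<p))

    distinct-positions : ∀ {i j} → i < p → j < p → i ≢ j → at (suc i) ≢ at (suc j)
    distinct-positions i<p j<p i≢j e =
      i≢j (suc-injective (at-injective (position-< (<⇒≤ (s≤s i<p))) (position-< (<⇒≤ (s≤s j<p))) e))

    step-up : ∀ {i} → suc i < suc (suc p) → Step (at i) (at (suc i))
    step-up {i} (s≤s i+1≤1+p) =
      step-at (position-< (≤-trans (n≤1+n i) i+1≤1+p)) (position-< i+1≤1+p) (∣n-1+n∣≡1 i)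

    step-down : ∀ {i} → suc i < suc (suc p) → Step (at (suc i)) (at i)
    step-down {i} (s≤s i+1≤1+p) =
      step-at (position-< i+1≤1+p) (position-< (≤-trans (n≤1+n i) i+1≤1+p)) (trans (∣-∣-comm (suc i) i) (∣n-1+n∣≡1 i))

    edge-up : Edge (pr m′ L₁) (at 0) (at m′)
    edge-up = crossing-walk ys-up isEnd-0 isEnd-m′ ends-distinct
      (λ z∈ → let (i , i<p , z≡) = ∈-applyUpTo⁻ (at ∘ suc) z∈ in trans (cong isEnd z≡) (inner-position i<p))
      (AllPairs.applyUpTo⁺₁ (at ∘ suc) p λ i<j j<p → distinct-positions (<-trans i<j j<p) j<p (<⇒≢ i<j))
      (trans (cong suc (length-applyUpTo (at ∘ suc) p)) 1+p≡m′)
      (subst (λ z → Linked Step (at 0 ∷ ys-up ++ [ at z ])) 1+p≡m′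
        (subst (λ zs → Linked Step (at 0 ∷ zs)) (sym (applyUpTo-∷ʳ (at ∘ suc) p)) (Linked.applyUpTo⁺₁ at (suc (suc p)) step-up)))

    edge-down : Edge (pr m′ L₁) (at m′) (at 0)
    edge-down = crossing-walk ys-down isEnd-m′ isEnd-0 (≢-sym ends-distinct)
      (λ z∈ → let (i , i<p , z≡) = ∈-applyDownFrom⁻ (at ∘ suc) z∈ in trans (cong isEnd z≡) (inner-position i<p))
      (AllPairs.applyDownFrom⁺₁ (at ∘ suc) p λ j<i i<p → distinct-positions i<p (<-trans j<i i<p) (≢-sym (<⇒≢ j<i)))
      (trans (cong suc (length-applyDownFrom (at ∘ suc) p)) 1+p≡m′)
      (subst (λ z → Linked Step (at z ∷ ys-down ++ [ at 0 ])) 1+p≡m′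
        (subst (λ zs → Linked Step (at (suc p) ∷ zs)) (sym (applyDownFrom-∷ʳ at p)) (Linked.applyDownFrom⁺₁ at (suc (suc p)) step-down)))

    root-light : ∀ {X} → isEnd X ≡ true → isRoot (pr m L₁) X ≡ true
    root-light {X} endX = cong₂ _∧_ (trans (vert-L₁ X) endX) (not-false (any-false⁺ _ (allFin n) λ {u} _ → from-below u))
      where
      from-below : ∀ u → ((toℕ u <ᵇ toℕ X) ∧ vert (pr m L₁) u ∧ reachK (pr m L₁) n u X) ≡ false
      from-below u rewrite reachK-sink (pr m L₁) (λ w → no-light-edge w X) n u with u ==F X in u==X
      ... | false = trans (cong ((toℕ u <ᵇ toℕ X) ∧_) (∧-zeroʳ _)) (∧-zeroʳ _)
      ... | true rewrite ==F-sound u X u==X | <ᵇ-false (<-irrefl {toℕ X} refl) = refl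

    not-root-heavy : ∀ {Y X} → toℕ Y < toℕ X → isEnd Y ≡ true → Edge (pr m′ L₁) Y X → isRoot (pr m′ L₁) X ≡ false
    not-root-heavy {Y} {X} Y<X endY edge = trans (cong (λ b → vert (pr m′ L₁) X ∧ not b)
      (any-true⁺ (λ u → (toℕ u <ᵇ toℕ X) ∧ vert (pr m′ L₁) u ∧ reachK (pr m′ L₁) n u X) (∈-allFin Y)
        (trans (cong₂ (λ a b → a ∧ b ∧ reachK (pr m′ L₁) n Y X) (<ᵇ-complete Y<X) (trans (vert-L₁ Y) endY))
          (reachK-edge (pr m′ L₁) n′ edge))))
      (∧-zeroʳ _)

    root₀-inner : ∀ {k v} → isRoot (pr k L₀) v ≡ true → isEnd v ≡ false
    root₀-inner {v = v} r = not-true (trans (sym (F₁ v)) (∧-trueˡ (∧-trueˡ r)))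

    root₁-end : ∀ {k v} → isRoot (pr k L₁) v ≡ true → isEnd v ≡ true
    root₁-end {v = v} r = trans (sym (vert-L₁ v)) (∧-trueˡ r)

    rk-< : ∀ {Y X} → toℕ Y < toℕ X → isEnd Y ≡ true → isEnd X ≡ true → Edge (pr m′ L₁) Y X → rk m G 𝓕 < rk m′ G 𝓕
    rk-< {Y} {X} Y<X endY endX edge = ∸-monoʳ-<′ (+-mono-≤-< c₀-anti (+-monoˡ-< 0 c₁-<))
      (subst (λ c → components (pr m′ L₀) + c < n) (sym (+-identityʳ _)) c₀+c₁<n)
      where
      c₁-< : components (pr m′ L₁) < components (pr m L₁)
      c₁-< = components-anti-< {G = pr m L₁} {H = pr m′ L₁} (λ _ → refl) (pr-⊆ᴱ L₁ (<⇒≤ m<m′)) (root-light endX) (not-root-heavy Y<X endY edge)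
      c₀-anti : components (pr m′ L₀) ≤ components (pr m L₀)
      c₀-anti = components-anti {G = pr m L₀} {H = pr m′ L₀} (λ _ → refl) (pr-⊆ᴱ L₀ (<⇒≤ m<m′))
      c₀+c₁<n : components (pr m′ L₀) + components (pr m′ L₁) < n
      c₀+c₁<n = components-+-< {G = pr m′ L₀} {H = pr m′ L₁}
        (λ v r₀ → ≢true⇒≡false λ r₁ → true≢false (trans (sym (root₁-end r₁)) (root₀-inner r₀)))
        (≢true⇒≡false λ r₀ → true≢false (trans (sym endX) (root₀-inner r₀)))
        (not-root-heavy Y<X endY edge)

    rk-strict : rk m G 𝓕 < rk m′ G 𝓕
    rk-strict with <-cmp (toℕ (at 0)) (toℕ (at m′))
    ... | tri< lt _ _ = rk-< lt isEnd-0 isEnd-m′ edge-up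
    ... | tri≈ _ e _ = ⊥-elim (ends-distinct (toℕ-injective e))
    ... | tri> _ _ gt = rk-< gt isEnd-m′ isEnd-0 edge-down

  Ψ-separated : ¬ (Ψ m (deco1 Γ) ≈Q Ψ m′ (deco1 Γ))
  Ψ-separated with g , 𝓕∈ , g≗ ← flag-complete n 2 endBlock endBlock-onto 2≤n =
    ranked-≉Q (flags n) type (λ 𝓕 → rk-mono (deco1 Γ) 𝓕 (<⇒≤ m<m′)) 𝓕∈ (WithFlag.rk-strict g g≗)

≈Q-sym : ∀ s t → s ≈Q t → t ≈Q s
≈Q-sym s t s≈t α r = sym (s≈t α r)

≅L⇒pairwiseDifferent : ∀ n (Γ : SimpleGraph n) → Γ ≅ L n → PairwiseDifferentΨ Γ
≅L⇒pairwiseDifferent (suc n′) Γ iso m m′ 1≤m m<n 1≤m′ m′<n m≢m′ with <-cmp m m′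
... | tri< m<m′ _ _ = Separation.Ψ-separated Γ iso m m′ 1≤m m<m′ m′<n
... | tri≈ _ m≡m′ _ = ⊥-elim (m≢m′ m≡m′)
... | tri> _ _ m′<m = Separation.Ψ-separated Γ iso m′ m 1≤m′ m′<m m<n ∘ ≈Q-sym (Ψ m (deco1 Γ)) (Ψ m′ (deco1 Γ))

≅-atMostOneVertex : ∀ {n} → n ≤ 1 → (Γ Δ : SimpleGraph n) → Γ ≅ Δ
≅-atMostOneVertex {zero} _ Γ Δ = ↔-id _ , λ ()
≅-atMostOneVertex {suc zero} _ Γ Δ = ↔-id _ , λ { Fin.zero Fin.zero → trans (irrefl Γ Fin.zero) (sym (irrefl Δ Fin.zero)) }
≅-atMostOneVertex {suc (suc _)} (s≤s ()) Γ Δ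

-- For n ≥ 3 it suffices that Ψ^{n-2} ≠ Ψ^{n-1}.
pairwiseDifferent⇒≅L : ∀ n → n ≢ 2 → (Γ : SimpleGraph n) → PairwiseDifferentΨ Γ → Γ ≅ L n
pairwiseDifferent⇒≅L zero _ Γ _ = ≅-atMostOneVertex z≤n Γ (L 0)
pairwiseDifferent⇒≅L (suc zero) _ Γ _ = ≅-atMostOneVertex ≤-refl Γ (L 1)
pairwiseDifferent⇒≅L (suc (suc zero)) n≢2 Γ _ = ⊥-elim (n≢2 refl)
pairwiseDifferent⇒≅L (suc (suc (suc k))) _ Γ different = Ψ-suc-≉Q⇒≅L (suc k) Γ
  (different (suc k) (suc (suc k)) (s≤s z≤n) (n≤1+n (suc (suc k))) (s≤s z≤n) ≤-refl (λ ()))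

mainTheorem4 : (n : ℕ) → ¬ (n ≡ 2) → (Γ : SimpleGraph n) →
    PairwiseDifferentΨ Γ ⇔ (Γ ≅ L n)
mainTheorem4 n n≢2 Γ = mk⇔ (pairwiseDifferent⇒≅L n n≢2 Γ) (≅L⇒pairwiseDifferent n Γ)
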